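{- Let $E$ be a finite set with a total order $\preceq$ and let $\mathcal{C}\subseteq 2^E$ be a clutter (no member contains another member). In the ZDD $\mathsf{Z}(\mathcal{C})$ with respect to $(E,\preceq)$, every non-terminal node $\nu$ satisfies $\nu_0\neq\nu_1$.
   Context: A decision diagram over $(E,\preceq)$ is a directed acyclic graph with a unique root, at most two terminal nodes, the 0-terminal $\bot$ and the 1-terminal $\top$, and non-terminal nodes $\nu$, each with a label $\ell(\nu)\in E$ and exactly two outgoing arcs, the 0-arc $(\nu,\nu_0)$ and the 1-arc $(\nu,\nu_1)$, with $\ell(\nu)\prec\ell(\nu_0),\ell(\nu_1)$ (terminal labels regarded as larger than all elements of $E$). The ZDD $\mathsf{Z}(\mathcal{S})$ of $\mathcal{S}\subseteq 2^E$ is the unique diagram obtained from the complete binary decision tree of $\mathcal{S}$ (internal nodes at depth $j$ labeled by the $(j+1)$-th smallest element of $E$; the leaf reached by taking 1-arcs exactly at the elements of $X$ is $\top$ iff $X\in\mathcal{S}$, else $\bot$) by exhaustively applying: (NS) merge non-terminal nodes with the same label, same 0-successor and same 1-successor; (Z-ND) remove every non-terminal $\nu$ with $\nu_1=\bot$, redirecting arcs entering $\nu$ to $\nu_0$. -}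

module Defs where

open import Data.Nat using (ℕ; zero; suc)
open import Data.Fin using (Fin; zero; suc)
open import Data.Bool using (Bool; true; false; if_then_else_)
open import Data.Vec using (Vec; []; _∷_)
open import Data.Fin.Subset using (Subset; _⊆_; inside; outside)
open import Relation.Binary.PropositionalEquality using (_≡_)

-- Ground set E = Fin n with its natural (total) order; every finite totally
-- ordered set is order-isomorphic to some Fin n.
-- A family 𝒮 ⊆ 2^E is given by its characteristic function.
Family : ℕ → Set
Family n = Subset n → Bool

Clutter : ∀ {n} → Family n → Set
Clutter {n} C = ∀ (X Y : Subset n) → C X ≡ true → C Y ≡ true → X ⊆ Y → X ≡ Y

-- A (fully NS-merged) DAG is represented by
-- its unfolding into a tree: after exhaustive NS merging two nodes are the
-- same node iff their unfoldings are equal, so node identity = ≡ on DD.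
data DD (n : ℕ) : Set where
  bot : DD n
  top : DD n
  node : Fin n → DD n → DD n → DD n    -- label, 0-successor, 1-successor

liftDD : ∀ {n} → DD n → DD (suc n)
liftDD bot = bot
liftDD top = top
liftDD (node l a b) = node (suc l) (liftDD a) (liftDD b)

decTree : ∀ n → Family n → DD n
decTree zero S = if S [] then top else bot
decTree (suc n) S =
  node zero (liftDD (decTree n (λ X → S (outside ∷ X))))
            (liftDD (decTree n (λ X → S (inside ∷ X))))

-- Z-ND rule at a node whose children are already reduced.
mkZ : ∀ {n} → Fin n → DD n → DD n → DD n
mkZ l a bot = a
mkZ l a top = node l a top
mkZ l a (node k c d) = node l a (node k c d)

-- Exhaustive application of Z-ND (NS merging is invisible on unfoldings).
zReduce : ∀ {n} → DD n → DD n
zReduce bot = bot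
zReduce top = top
zReduce (node l a b) = mkZ l (zReduce a) (zReduce b)

ZDD : ∀ n → Family n → DD n
ZDD n S = zReduce (decTree n S)

data _∈DD_ {n : ℕ} : DD n → DD n → Set where
  here  : ∀ {d} → d ∈DD d
  via0  : ∀ {ν l a b} → ν ∈DD a → ν ∈DD node l a b
  via1  : ∀ {ν l a b} → ν ∈DD b → ν ∈DD node l a b

-- Over the ground set Fin (1 + n) the ZDD of S is obtained by applying the
-- Z-ND rule to a root labelled 0 whose children are the (relabelled) ZDDs of
-- the cofactors S₀ = {X : 0 ∉ X} and S₁ = {X ∖ {0} : 0 ∈ X}. The ZDD
-- determines its family, so if the root survives (S₁ ≠ ∅) and its children
-- coincide, then S₀ = S₁ ∋ X, i.e. both X and X ∪ {0} belong to S, which a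
-- clutter forbids. Cofactors of clutters are clutters, and relabelling
-- preserves distinct children, so induction on n covers the remaining nodes.
module Submission where

open import Defs
open import Data.Nat using (ℕ; zero; suc)
open import Data.Fin using (Fin; zero; suc)
open import Data.Bool using (Bool; true; false)
open import Data.Vec using ([]; _∷_)
open import Data.Vec.Properties using (∷-injectiveʳ)
open import Data.Fin.Subset using (inside; outside)
open import Data.Fin.Subset.Properties using (s⊆s; out⊆; ⊆-refl)
open import Data.Product using (_×_; _,_; ∃-syntax)
open import Data.Product.Properties using (,-injective)
open import Function using (_∘′_)
open import Data.Sum using (_⊎_; inj₁; inj₂)
open import Relation.Nullary using (¬_)
open import Relation.Binary.PropositionalEquality
  using (_≡_; _≢_; refl; sym; trans; cong)

private
  variable
    n : ℕ

cofactor : Bool → Family (suc n) → Family n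
cofactor b S X = S (b ∷ X)

cofactor-clutter : ∀ b {C : Family (suc n)} → Clutter C → Clutter (cofactor b C)
cofactor-clutter b clutter X Y X∈C Y∈C X⊆Y =
  ∷-injectiveʳ (clutter _ _ X∈C Y∈C (s⊆s X⊆Y))

clutter-cofactors-disjoint : ∀ {C : Family (suc n)} → Clutter C → ∀ X →
  cofactor outside C X ≡ true → ¬ cofactor inside C X ≡ true
clutter-cofactors-disjoint clutter X X∈C₀ X∈C₁
  with () ← clutter _ _ X∈C₀ X∈C₁ (out⊆ ⊆-refl)

-- Nodes labelled zero have no preimage under liftDD; they are sent to bot.
lowerDD : DD (suc n) → DD n
lowerDD bot = bot
lowerDD top = top
lowerDD (node zero a b) = bot
lowerDD (node (suc l) a b) = node l (lowerDD a) (lowerDD b)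

lowerDD-liftDD : (d : DD n) → lowerDD (liftDD d) ≡ d
lowerDD-liftDD bot = refl
lowerDD-liftDD top = refl
lowerDD-liftDD (node l a b)
  rewrite lowerDD-liftDD a | lowerDD-liftDD b = refl

liftDD-injective : {a b : DD n} → liftDD a ≡ liftDD b → a ≡ b
liftDD-injective {a = a} {b} e =
  trans (sym (lowerDD-liftDD a)) (trans (cong lowerDD e) (lowerDD-liftDD b))

mkZ-liftDD : (l : Fin n) (a b : DD n) →
  mkZ (suc l) (liftDD a) (liftDD b) ≡ liftDD (mkZ l a b)
mkZ-liftDD l a bot = refl
mkZ-liftDD l a top = refl
mkZ-liftDD l a (node k c d) = refl

zReduce-liftDD : (d : DD n) → zReduce (liftDD d) ≡ liftDD (zReduce d)
zReduce-liftDD bot = refl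
zReduce-liftDD top = refl
zReduce-liftDD (node l a b)
  rewrite zReduce-liftDD a | zReduce-liftDD b = mkZ-liftDD l (zReduce a) (zReduce b)

ZDD-suc : ∀ n (S : Family (suc n)) →
  ZDD (suc n) S ≡ mkZ zero (liftDD (ZDD n (cofactor outside S)))
                           (liftDD (ZDD n (cofactor inside S)))
ZDD-suc n S
  rewrite zReduce-liftDD (decTree n (cofactor outside S))
        | zReduce-liftDD (decTree n (cofactor inside S)) = refl

-- Recovers (a , b) from the diagram built by ZDD-suc: a root labelled zero
-- has survived the Z-ND rule, any other root means the 1-child was bot.
cofactorsDD : DD (suc n) → DD n × DD n
cofactorsDD (node zero a b) = lowerDD a , lowerDD b
cofactorsDD d = lowerDD d , bot

cofactorsDD-liftDD : (a : DD n) → cofactorsDD (liftDD a) ≡ (a , bot)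
cofactorsDD-liftDD bot = refl
cofactorsDD-liftDD top = refl
cofactorsDD-liftDD (node l a b)
  rewrite lowerDD-liftDD a | lowerDD-liftDD b = refl

cofactorsDD-mkZ : (a b : DD n) →
  cofactorsDD (mkZ zero (liftDD a) (liftDD b)) ≡ (a , b)
cofactorsDD-mkZ a bot = cofactorsDD-liftDD a
cofactorsDD-mkZ a top rewrite lowerDD-liftDD a = refl
cofactorsDD-mkZ a (node l c d)
  rewrite lowerDD-liftDD a | lowerDD-liftDD (node l c d) = refl

cofactorsDD-ZDD : ∀ n (S : Family (suc n)) → cofactorsDD (ZDD (suc n) S)
                  ≡ (ZDD n (cofactor outside S) , ZDD n (cofactor inside S))
cofactorsDD-ZDD n S rewrite ZDD-suc n S = cofactorsDD-mkZ _ _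

ZDD-cofactors-injective : ∀ n {S T : Family (suc n)} → ZDD (suc n) S ≡ ZDD (suc n) T →
  ∀ b → ZDD n (cofactor b S) ≡ ZDD n (cofactor b T)
ZDD-cofactors-injective n {S} {T} e b with ,-injective cofactors≡
  where
  cofactors≡ : (ZDD n (cofactor outside S) , ZDD n (cofactor inside S))
             ≡ (ZDD n (cofactor outside T) , ZDD n (cofactor inside T))
  cofactors≡ = trans (sym (cofactorsDD-ZDD n S)) (trans (cong cofactorsDD e) (cofactorsDD-ZDD n T))
ZDD-cofactors-injective n e outside | Z₀≡ , _ = Z₀≡
ZDD-cofactors-injective n e inside  | _ , Z₁≡ = Z₁≡

isTop : DD n → Bool
isTop top = true
isTop _ = false

isTop-ZDD-zero : (S : Family zero) → isTop (ZDD zero S) ≡ S []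
isTop-ZDD-zero S with S []
... | true  = refl
... | false = refl

ZDD-injective : ∀ n {S T : Family n} → ZDD n S ≡ ZDD n T → ∀ X → S X ≡ T X
ZDD-injective zero {S} {T} e [] =
  trans (sym (isTop-ZDD-zero S)) (trans (cong isTop e) (isTop-ZDD-zero T))
ZDD-injective (suc n) {S} {T} e (b ∷ X) =
  ZDD-injective n (ZDD-cofactors-injective n {S} {T} e b) X

ZDD≡bot⊎member : ∀ n (S : Family n) → ZDD n S ≡ bot ⊎ ∃[ X ] S X ≡ true
ZDD≡bot⊎member zero S with S [] in X∈S
... | true  = inj₂ ([] , X∈S)
... | false = inj₁ refl
ZDD≡bot⊎member (suc n) S rewrite ZDD-suc n S with ZDD≡bot⊎member n (cofactor inside S)
... | inj₂ (X , X∈S₁) = inj₂ (inside ∷ X , X∈S₁)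
... | inj₁ Z₁≡bot rewrite Z₁≡bot with ZDD≡bot⊎member n (cofactor outside S)
...   | inj₂ (X , X∈S₀) = inj₂ (outside ∷ X , X∈S₀)
...   | inj₁ Z₀≡bot rewrite Z₀≡bot = inj₁ refl

clutter-ZDD-cofactors-distinct : ∀ n {C : Family (suc n)} → Clutter C →
  ZDD n (cofactor inside C) ≢ bot →
  ZDD n (cofactor outside C) ≢ ZDD n (cofactor inside C)
clutter-ZDD-cofactors-distinct n {C} clutter Z₁≢bot Z₀≡Z₁
  with ZDD≡bot⊎member n (cofactor inside C)
... | inj₁ Z₁≡bot = Z₁≢bot Z₁≡bot
... | inj₂ (X , X∈C₁) = clutter-cofactors-disjoint clutter X
  (trans (ZDD-injective n Z₀≡Z₁ X) X∈C₁) X∈C₁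

DistinctChildren : DD n → Set
DistinctChildren d = ∀ l ν₀ ν₁ → node l ν₀ ν₁ ∈DD d → ν₀ ≢ ν₁

∈DD-liftDD : (d : DD n) {ν : DD (suc n)} → ν ∈DD liftDD d →
  ∃[ ν′ ] ν′ ∈DD d × ν ≡ liftDD ν′
∈DD-liftDD bot here = bot , here , refl
∈DD-liftDD top here = top , here , refl
∈DD-liftDD (node l a b) here = node l a b , here , refl
∈DD-liftDD (node l a b) (via0 ν∈a) with ∈DD-liftDD a ν∈a
... | ν′ , ν′∈a , ν≡ = ν′ , via0 ν′∈a , ν≡
∈DD-liftDD (node l a b) (via1 ν∈b) with ∈DD-liftDD b ν∈b
... | ν′ , ν′∈b , ν≡ = ν′ , via1 ν′∈b , ν≡

liftDD-distinctChildren : (d : DD n) → DistinctChildren d → DistinctChildren (liftDD d)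
liftDD-distinctChildren d distinct l ν₀ ν₁ ν∈d with ∈DD-liftDD d ν∈d
... | node l′ ν₀′ ν₁′ , ν′∈d , refl = distinct l′ ν₀′ ν₁′ ν′∈d ∘′ liftDD-injective

mkZ-distinctChildren : (l : Fin n) (a b : DD n) →
  DistinctChildren a → DistinctChildren b → (b ≢ bot → a ≢ b) →
  DistinctChildren (mkZ l a b)
mkZ-distinctChildren l a bot distinctA _ _ = distinctA
mkZ-distinctChildren l a top distinctA distinctB a≢b = λ
  { _ _ _ here → a≢b λ ()
  ; k c d (via0 ν∈a) → distinctA k c d ν∈a
  ; k c d (via1 ν∈b) → distinctB k c d ν∈b
  }
mkZ-distinctChildren l a (node _ _ _) distinctA distinctB a≢b = λ
  { _ _ _ here → a≢b λ ()
  ; k c d (via0 ν∈a) → distinctA k c d ν∈a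
  ; k c d (via1 ν∈b) → distinctB k c d ν∈b
  }

lemma3p2 : ∀ (n : ℕ) (C : Family n) → Clutter C →
    ∀ (l : Fin n) (ν₀ ν₁ : DD n) → node l ν₀ ν₁ ∈DD ZDD n C → ν₀ ≢ ν₁
lemma3p2 zero C _ with C []
... | true  = λ _ _ _ ()
... | false = λ _ _ _ ()
lemma3p2 (suc n) C clutter rewrite ZDD-suc n C =
  mkZ-distinctChildren zero (liftDD Z₀) (liftDD Z₁)
    (liftDD-distinctChildren Z₀ (lemma3p2 n (cofactor outside C) (cofactor-clutter outside clutter)))
    (liftDD-distinctChildren Z₁ (lemma3p2 n (cofactor inside C) (cofactor-clutter inside clutter)))
    (λ liftZ₁≢bot Z₀≡Z₁ →
      clutter-ZDD-cofactors-distinct n clutter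
        (λ Z₁≡bot → liftZ₁≢bot (cong liftDD Z₁≡bot))
        (liftDD-injective Z₀≡Z₁))
  where
  Z₀ Z₁ : DD n
  Z₀ = ZDD n (cofactor outside C)
  Z₁ = ZDD n (cofactor inside C)
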